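{- Let $n\in\mathbb N$ and let $q_0,q_1,\dots,q_n$ be positive integers such that $q_{j+1}$ divides $q_j$ for every $0\le j<n$. Then there exists $x\in\mathbb Q$ such that for each $0\le j\le n$, $\chi^j(x)=\frac{p_j}{q_j}$ for some integer $p_j$ with $\gcd(p_j,q_j)=1$.
   Context: Let $\chi:\mathbb Q\to\mathbb Q$ be defined by $\chi(x)=x\lceil x\rceil$, where $\lceil x\rceil$ is the smallest integer greater than or equal to $x$; $\chi^j$ denotes the $j$-th iterate ($\chi^0$ the identity). -}

module Defs where

open import Data.Nat using (ℕ; zero; suc)
open import Data.Integer using (ℤ)
open import Data.Rational using (ℚ; _*_; _/_; ceiling)

χ : ℚ → ℚ
χ x = x * (ceiling x / 1)

χ^ : ℕ → ℚ → ℚ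
χ^ zero    x = x
χ^ (suc j) x = χ (χ^ j x)

module Submission where

-- Every x = N + 1/a (with a ≥ 1) is the fraction (N·a + 1)/a in lowest terms,
-- and ⌈x⌉ = N + 1, so χ(x) = (N·a + 1)(N + 1)/a.  If a = D·b and
-- N ≡ D - 1 (mod a), say N = D - 1 + a·k, this equals N' + 1/b with
-- N' = N(N + 1) + k: one application of χ turns denominator a into b.
--
-- Hence the admissible N form a residue class.  By induction on the length
-- m of the chain q₀, q₁, …, q_m we find R such that every N ≡ R (mod q₀^m)
-- gives an x = N + 1/q₀ whose orbit has the prescribed reduced denominators.
-- For the inductive step we need k with N'(k) ≡ R' (mod q₀^m), where R' is
-- the residue for the shifted chain q₁, …, q_m; the map k ↦ N'(k) has
-- "unit slope" modulo q₀, so such k exists by a Hensel-type lifting.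

open import Defs
open import Data.Nat using (ℕ; suc; _<_; _≤_; NonZero)
open import Data.Nat.Divisibility using (_∣_)
open import Data.Nat.Coprimality using (Coprime)
open import Data.Integer using (ℤ; ∣_∣)
open import Data.Rational using (ℚ; _/_)
open import Data.Product using (Σ; _×_)
open import Relation.Binary.PropositionalEquality using (_≡_)

open import Data.Nat as ℕ using (zero; z≤n; s≤s)
import Data.Nat.Properties as ℕ
import Data.Nat.Divisibility as ℕ
import Data.Nat.Coprimality as ℕ
import Data.Nat.GCD as ℕ
open import Data.Integer as ℤ using (+_; -[1+_]; +[1+_]; -_; _+_; _-_; _*_; _^_; 0ℤ; 1ℤ)
import Data.Integer.Properties as ℤ
open import Data.Integer.DivMod using (_/ℕ_; [n/ℕd]*d≤n; n<s[n/ℕd]*d; div-pos-is-/ℕ)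
open import Data.Integer.Divisibility.Signed
  using (divides; ∣-refl; ∣-trans; ∣n⇒∣m*n; *-monoˡ-∣; *-monoʳ-∣; ∣m∣n⇒∣m+n; ∣m+n∣m⇒∣n; ∣⇒∣ᵤ; ∣ᵤ⇒∣)
  renaming (_∣_ to _∣ᶻ_)
open import Data.Integer.Tactic.RingSolver using (solve-∀)
open import Data.Rational as ℚ using (mkℚ; ↥_; ↧_; ceiling)
import Data.Rational.Properties as ℚ
import Data.Rational.Unnormalised as ℚᵘ
import Data.Rational.Unnormalised.Properties as ℚᵘ
open import Data.Product using (_,_; proj₁; proj₂)
open import Relation.Binary.PropositionalEquality
  using (refl; sym; trans; cong; subst; module ≡-Reasoning)

^-monoˡ-∣ : ∀ m {i j} → i ∣ᶻ j → i ^ m ∣ᶻ j ^ m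
^-monoˡ-∣ zero    _   = ∣-refl
^-monoˡ-∣ (suc m) {i} {j} i∣j =
  ∣-trans (*-monoˡ-∣ (i ^ m) i∣j) (*-monoʳ-∣ j (^-monoˡ-∣ m i∣j))

UnitSlope : ℤ → (ℤ → ℤ) → Set
UnitSlope Q f = ∀ k u → Q * u ∣ᶻ f (k + u) - f k - u

unitSlope-cong : ∀ Q f {M k u T} → UnitSlope Q f →
                 M ∣ᶻ u → M ∣ᶻ f k - T → M ∣ᶻ f (k + u) - T
unitSlope-cong Q f {M} {k} {u} {T} slope M∣u M∣fk-T =
  subst (M ∣ᶻ_) (sym (regroup (f (k + u)) (f k) T u))
    (∣m∣n⇒∣m+n (∣m∣n⇒∣m+n (∣-trans (∣n⇒∣m*n Q M∣u) (slope k u)) M∣u) M∣fk-T)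
  where
  regroup : ∀ A B T u → A - T ≡ (A - B - u + u) + (B - T)
  regroup = solve-∀

-- Hensel lifting: a unit-slope map hits every class modulo every power of Q.
-- If f(k) - T = t·Qᵐ, replacing k by k - t·Qᵐ kills this error modulo Qᵐ⁺¹.
hensel : ∀ Q f → UnitSlope Q f → ∀ m T → Σ ℤ λ k → Q ^ m ∣ᶻ f k - T
hensel Q f _ zero T = 0ℤ , divides (f 0ℤ - T) (sym (ℤ.*-identityʳ _))
hensel Q f slope (suc m) T with hensel Q f slope m T
... | k , divides t fk-T≡tQᵐ =
  k + u , subst (Q ^ suc m ∣ᶻ_) (sym error≡slopeTerm) (∣-trans Qᵐ⁺¹∣Qu (slope k u))
  where
  open ≡-Reasoning
  u : ℤ
  u = - (t * Q ^ m)

  Qᵐ⁺¹∣Qu : Q ^ suc m ∣ᶻ Q * u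
  Qᵐ⁺¹∣Qu = divides (- t) (rearrange Q t (Q ^ m))
    where
    rearrange : ∀ Q t P → Q * - (t * P) ≡ - t * (Q * P)
    rearrange = solve-∀

  regroup : ∀ A B T u → A - T ≡ (A - B - u) + ((B - T) + u)
  regroup = solve-∀

  error≡slopeTerm : f (k + u) - T ≡ f (k + u) - f k - u
  error≡slopeTerm = begin
    f (k + u) - T                          ≡⟨ regroup (f (k + u)) (f k) T u ⟩
    (f (k + u) - f k - u) + ((f k - T) + u) ≡⟨ cong (λ e → (f (k + u) - f k - u) + (e + u)) fk-T≡tQᵐ ⟩
    (f (k + u) - f k - u) + (t * Q ^ m + u) ≡⟨ cong (λ e → (f (k + u) - f k - u) + e) (ℤ.+-inverseʳ (t * Q ^ m)) ⟩
    (f (k + u) - f k - u) + 0ℤ              ≡⟨ ℤ.+-identityʳ _ ⟩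
    f (k + u) - f k - u                    ∎

/ℕ-unique : ∀ n d .{{_ : NonZero d}} z → z * + d ℤ.≤ n → n ℤ.< ℤ.suc z * + d → n /ℕ d ≡ z
/ℕ-unique n d z lower upper = ℤ.≤-antisym q≤z z≤q
  where
  q : ℤ
  q = n /ℕ d
  q≤z : q ℤ.≤ z
  q≤z = ℤ.≮⇒≥ λ z<q → ℤ.<⇒≱ upper
    (ℤ.≤-trans (ℤ.*-monoʳ-≤-nonNeg (+ d) (ℤ.i<j⇒suc[i]≤j z<q)) ([n/ℕd]*d≤n n d))
  z≤q : z ℤ.≤ q
  z≤q = ℤ.≮⇒≥ λ q<z → ℤ.<⇒≱ (n<s[n/ℕd]*d n d)
    (ℤ.≤-trans (ℤ.*-monoʳ-≤-nonNeg (+ d) (ℤ.i<j⇒suc[i]≤j q<z)) lower)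

ceiling-/ℕ : ∀ p {i d} .{{_ : NonZero d}} → ↥ p ≡ i → ↧ p ≡ + d → ceiling p ≡ - ((- i) /ℕ d)
ceiling-/ℕ (mkℚ (+ zero)  d _) refl refl = cong -_ (div-pos-is-/ℕ (+ zero) (suc d))
ceiling-/ℕ (mkℚ +[1+ n ] d _) refl refl = cong -_ (div-pos-is-/ℕ -[1+ n ] (suc d))
ceiling-/ℕ (mkℚ -[1+ n ] d _) refl refl = cong -_ (div-pos-is-/ℕ +[1+ n ] (suc d))

↥-coprime-/ : ∀ i d .{{_ : NonZero d}} → Coprime ∣ i ∣ d → ↥ (i / d) ≡ i
↥-coprime-/ i d coprime = begin
  ↥ (i / d)                    ≡⟨ ℤ.*-identityʳ _ ⟨
  ↥ (i / d) * + 1              ≡⟨ cong (λ g → ↥ (i / d) * + g) (ℕ.coprime⇒gcd≡1 coprime) ⟨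
  ↥ (i / d) * + ℕ.gcd ∣ i ∣ d  ≡⟨ ℚ.↥-/ i d ⟩
  i                            ∎
  where open ≡-Reasoning

↧-coprime-/ : ∀ i d .{{_ : NonZero d}} → Coprime ∣ i ∣ d → ↧ (i / d) ≡ + d
↧-coprime-/ i d coprime = begin
  ↧ (i / d)                    ≡⟨ ℤ.*-identityʳ _ ⟨
  ↧ (i / d) * + 1              ≡⟨ cong (λ g → ↧ (i / d) * + g) (ℕ.coprime⇒gcd≡1 coprime) ⟨
  ↧ (i / d) * + ℕ.gcd ∣ i ∣ d  ≡⟨ ℚ.↧-/ i d ⟩
  + d                          ∎
  where open ≡-Reasoning

/-*-integer : ∀ i c j a b .{{_ : NonZero a}} .{{_ : NonZero b}} →
              i * c * + b ≡ j * + a → (i / a) ℚ.* (c / 1) ≡ j / b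
/-*-integer i c j (suc a) (suc b) cross = ℚ.toℚᵘ-injective (begin
  ℚ.toℚᵘ ((i / suc a) ℚ.* (c / 1))              ≈⟨ ℚ.toℚᵘ-homo-* (i / suc a) (c / 1) ⟩
  ℚ.toℚᵘ (i / suc a) ℚᵘ.* ℚ.toℚᵘ (c / 1)        ≈⟨ ℚᵘ.*-cong (ℚ.toℚᵘ-fromℚᵘ (ℚᵘ.mkℚᵘ i a))
                                                              (ℚ.toℚᵘ-fromℚᵘ (ℚᵘ.mkℚᵘ c 0)) ⟩
  ℚᵘ.mkℚᵘ i a ℚᵘ.* ℚᵘ.mkℚᵘ c 0                  ≈⟨ ℚᵘ.*≡* (trans cross (cong (j *_) (sym (ℤ.*-identityʳ _)))) ⟩
  ℚᵘ.mkℚᵘ j b                                    ≈⟨ ℚ.toℚᵘ-fromℚᵘ (ℚᵘ.mkℚᵘ j b) ⟨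
  ℚ.toℚᵘ (j / suc b)                             ∎)
  where open ℚᵘ.≃-Reasoning

plusRecip : ℤ → (a : ℕ) .{{_ : NonZero a}} → ℚ
plusRecip N a = (N * + a + 1ℤ) / a

plusRecip-coprime : ∀ N a → Coprime ∣ N * + a + 1ℤ ∣ a
plusRecip-coprime N a (d∣num , d∣a) = ℕ.∣1⇒≡1 (∣⇒∣ᵤ {k = + _} {i = 1ℤ}
  (∣m+n∣m⇒∣n {m = N * + a} (∣ᵤ⇒∣ d∣num) (∣n⇒∣m*n N (∣ᵤ⇒∣ {i = + a} d∣a))))

-- Floor division of -(N·a + 1) by a is -(N + 1): -(N + 1)·a ≤ -(N·a + 1) < -N·a.
neg-plusRecip-/ℕ : ∀ N a .{{_ : NonZero a}} → (- (N * + a + 1ℤ)) /ℕ a ≡ - (N + 1ℤ)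
neg-plusRecip-/ℕ N (suc a) = /ℕ-unique _ (suc a) z
  (subst (z * + suc a ℤ.≤_) (sym split) (ℤ.i≤i+j _ (+ a)))
  (subst (ℤ._< ℤ.suc z * + suc a) (sym split)
    (subst (z * + suc a + + a ℤ.<_) (next-multiple z (+ a))
      (ℤ.+-monoʳ-< (z * + suc a) (ℤ.+<+ (ℕ.n<1+n a)))))
  where
  z : ℤ
  z = - (N + 1ℤ)
  remainder : ∀ N A → - (N * (1ℤ + A) + 1ℤ) ≡ (- (N + 1ℤ)) * (1ℤ + A) + A
  remainder = solve-∀
  split : - (N * + suc a + 1ℤ) ≡ z * + suc a + + a
  split = remainder N (+ a)
  next-multiple : ∀ z A → z * (1ℤ + A) + (1ℤ + A) ≡ (1ℤ + z) * (1ℤ + A)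
  next-multiple = solve-∀

ceiling-plusRecip : ∀ N a .{{_ : NonZero a}} → ceiling (plusRecip N a) ≡ N + 1ℤ
ceiling-plusRecip N a = begin
  ceiling (plusRecip N a)        ≡⟨ ceiling-/ℕ (plusRecip N a) (↥-coprime-/ (N * + a + 1ℤ) a coprime) (↧-coprime-/ (N * + a + 1ℤ) a coprime) ⟩
  - ((- (N * + a + 1ℤ)) /ℕ a)    ≡⟨ cong -_ (neg-plusRecip-/ℕ N a) ⟩
  - - (N + 1ℤ)                   ≡⟨ ℤ.neg-involutive _ ⟩
  N + 1ℤ                         ∎
  where
  open ≡-Reasoning
  coprime : Coprime ∣ N * + a + 1ℤ ∣ a
  coprime = plusRecip-coprime N a

-- The parametrisation N = D - 1 + a·k of the class N ≡ D - 1 (mod a),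
-- and the integer part N' = N(N + 1) + k of χ(N + 1/a) (see χ-plusRecip).
lift : ℤ → ℤ → ℤ → ℤ
lift D a k = D - 1ℤ + a * k

next : ℤ → ℤ → ℤ → ℤ
next D a k = lift D a k * (lift D a k + 1ℤ) + k

-- One step of χ: if a = D·b then χ(N + 1/a) = N' + 1/b for N = lift D a k.
-- Indeed N + 1 = D(1 + b·k), so (N·a + 1)(N + 1)·b = (N'·b + 1)·a.
χ-plusRecip : ∀ D k a b .{{_ : NonZero a}} .{{_ : NonZero b}} → + a ≡ D * + b →
              χ (plusRecip (lift D (+ a) k) a) ≡ plusRecip (next D (+ a) k) b
χ-plusRecip D k a b a≡Db = begin
  χ (plusRecip N a)                     ≡⟨ cong (λ c → plusRecip N a ℚ.* (c / 1)) (ceiling-plusRecip N a) ⟩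
  plusRecip N a ℚ.* ((N + 1ℤ) / 1)      ≡⟨ /-*-integer (N * + a + 1ℤ) (N + 1ℤ) (next D (+ a) k * + b + 1ℤ) a b cross ⟩
  plusRecip (next D (+ a) k) b          ∎
  where
  open ≡-Reasoning
  N : ℤ
  N = lift D (+ a) k

  identity : ∀ D B k →
    ((D - 1ℤ + D * B * k) * (D * B) + 1ℤ) * ((D - 1ℤ + D * B * k) + 1ℤ) * B
      ≡ (((D - 1ℤ + D * B * k) * ((D - 1ℤ + D * B * k) + 1ℤ) + k) * B + 1ℤ) * (D * B)
  identity = solve-∀

  cross : (N * + a + 1ℤ) * (N + 1ℤ) * + b ≡ (next D (+ a) k * + b + 1ℤ) * + a
  cross = begin
    (N * + a + 1ℤ) * (N + 1ℤ) * + b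
      ≡⟨ cong (λ A → (lift D A k * A + 1ℤ) * (lift D A k + 1ℤ) * + b) a≡Db ⟩
    (lift D (D * + b) k * (D * + b) + 1ℤ) * (lift D (D * + b) k + 1ℤ) * + b
      ≡⟨ identity D (+ b) k ⟩
    (next D (D * + b) k * + b + 1ℤ) * (D * + b)
      ≡⟨ cong (λ A → (next D A k * + b + 1ℤ) * A) (sym a≡Db) ⟩
    (next D (+ a) k * + b + 1ℤ) * + a ∎

next-unitSlope : ∀ D a → UnitSlope a (next D a)
next-unitSlope D a k u = divides (lift D a k + lift D a k + a * u + 1ℤ) (expanded D a k u)
  where
  expanded : ∀ D a k u →
    (D - 1ℤ + a * (k + u)) * (D - 1ℤ + a * (k + u) + 1ℤ) + (k + u)
      - ((D - 1ℤ + a * k) * (D - 1ℤ + a * k + 1ℤ) + k) - u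
      ≡ ((D - 1ℤ + a * k) + (D - 1ℤ + a * k) + a * u + 1ℤ) * (a * u)
  expanded = solve-∀

HasReducedDenominator : (d : ℕ) .{{_ : NonZero d}} → ℚ → Set
HasReducedDenominator d x = Σ ℤ λ p → Coprime ∣ p ∣ d × (x ≡ p / d)

ReducedOrbit : (m : ℕ) (q : ℕ → ℕ) → (∀ j → j ≤ m → NonZero (q j)) → ℚ → Set
ReducedOrbit m q qpos x = ∀ j → (j≤m : j ≤ m) → HasReducedDenominator (q j) {{qpos j j≤m}} (χ^ j x)

plusRecip-reduced : ∀ N a .{{_ : NonZero a}} → HasReducedDenominator a (plusRecip N a)
plusRecip-reduced N a = N * + a + 1ℤ , plusRecip-coprime N a , refl

χ^-suc : ∀ j x → χ^ (suc j) x ≡ χ^ j (χ x)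
χ^-suc zero    x = refl
χ^-suc (suc j) x = cong χ (χ^-suc j x)

shiftPos : ∀ {m} {q : ℕ → ℕ} → (∀ j → j ≤ suc m → NonZero (q j)) →
           ∀ j → j ≤ m → NonZero (q (suc j))
shiftPos qpos j j≤m = qpos (suc j) (s≤s j≤m)

reducedOrbit-cons : ∀ {m q qpos x} → HasReducedDenominator (q 0) {{qpos 0 z≤n}} x →
                    ReducedOrbit m (λ j → q (suc j)) (shiftPos qpos) (χ x) →
                    ReducedOrbit (suc m) q qpos x
reducedOrbit-cons first _    zero    z≤n       = first
reducedOrbit-cons {x = x} _ rest (suc j) (s≤s j≤m) with rest j j≤m
... | p , coprime , eq = p , coprime , trans (χ^-suc j x) eq

residueClass : ∀ m (q : ℕ → ℕ) (qpos : ∀ j → j ≤ m → NonZero (q j)) →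
               (∀ j → j < m → q (suc j) ∣ q j) →
               Σ ℤ λ R → ∀ N → (+ q 0) ^ m ∣ᶻ N - R →
                 ReducedOrbit m q qpos (plusRecip N (q 0) {{qpos 0 z≤n}})
residueClass zero q qpos _ = 0ℤ , orbit
  where
  orbit : ∀ N → 1ℤ ∣ᶻ N - 0ℤ → ReducedOrbit zero q qpos (plusRecip N (q 0) {{qpos 0 z≤n}})
  orbit N _ zero z≤n = plusRecip-reduced N (q 0) {{qpos 0 z≤n}}
residueClass (suc m) q qpos q∣
  with q∣ 0 (s≤s z≤n)
     | residueClass m (λ j → q (suc j)) (shiftPos qpos) (λ j j<m → q∣ (suc j) (s≤s j<m))
... | ℕ.divides D q₀≡Dq₁ | R′ , orbit′ = lift (+ D) A k , orbit
  where
  instance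
    q₀≢0 : NonZero (q 0)
    q₀≢0 = qpos 0 z≤n
    q₁≢0 : NonZero (q 1)
    q₁≢0 = qpos 1 (s≤s z≤n)

  A : ℤ
  A = + q 0
  A≡DB : A ≡ + D * + q 1
  A≡DB = trans (cong +_ q₀≡Dq₁) (ℤ.pos-* D (q 1))

  lifted : Σ ℤ λ k → A ^ m ∣ᶻ next (+ D) A k - R′
  lifted = hensel A (next (+ D) A) (next-unitSlope (+ D) A) m R′
  k : ℤ
  k = proj₁ lifted

  orbit : ∀ N → A ^ suc m ∣ᶻ N - lift (+ D) A k → ReducedOrbit (suc m) q qpos (plusRecip N (q 0))
  orbit N (divides t N-R≡) = reducedOrbit-cons {q = q} {qpos = qpos} (plusRecip-reduced N (q 0))
    (subst (ReducedOrbit m (λ j → q (suc j)) (shiftPos qpos)) (sym χ-step) (orbit′ N′ N′≡R′))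
    where
    open ≡-Reasoning
    u : ℤ
    u = t * A ^ m
    N′ : ℤ
    N′ = next (+ D) A (k + u)

    shift : ∀ N R → N ≡ R + (N - R)
    shift = solve-∀
    absorb : ∀ D A k t P → (D - 1ℤ + A * k) + t * (A * P) ≡ D - 1ℤ + A * (k + t * P)
    absorb = solve-∀

    N≡lift : N ≡ lift (+ D) A (k + u)
    N≡lift = begin
      N                                      ≡⟨ shift N (lift (+ D) A k) ⟩
      lift (+ D) A k + (N - lift (+ D) A k)   ≡⟨ cong (λ e → lift (+ D) A k + e) N-R≡ ⟩
      lift (+ D) A k + t * (A * A ^ m)        ≡⟨ absorb (+ D) A k t (A ^ m) ⟩
      lift (+ D) A (k + u)                   ∎

    χ-step : χ (plusRecip N (q 0)) ≡ plusRecip N′ (q 1)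
    χ-step = trans (cong (λ M → χ (plusRecip M (q 0))) N≡lift) (χ-plusRecip (+ D) (k + u) (q 0) (q 1) A≡DB)

    -- N′ ≡ R′ modulo Aᵐ, hence modulo (q 1)ᵐ, which divides Aᵐ.
    N′≡R′ : (+ q 1) ^ m ∣ᶻ N′ - R′
    N′≡R′ = ∣-trans (^-monoˡ-∣ m (divides (+ D) A≡DB))
      (unitSlope-cong A (next (+ D) A) (next-unitSlope (+ D) A) (divides t refl) (proj₂ lifted))

mainTheorem4 : (n : ℕ) (q : ℕ → ℕ) →
    (qpos : ∀ j → j ≤ n → NonZero (q j)) →
    (∀ j → j < n → q (suc j) ∣ q j) →
    Σ ℚ λ x → ∀ j → (j≤n : j ≤ n) →
      Σ ℤ λ p → Coprime ∣ p ∣ (q j) × (χ^ j x ≡ (_/_ p (q j) {{qpos j j≤n}}))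
mainTheorem4 n q qpos q∣ with residueClass n q qpos q∣
... | R , orbit = plusRecip R (q 0) {{qpos 0 z≤n}} , orbit R R≡R
  where
  R≡R : (+ q 0) ^ n ∣ᶻ R - R
  R≡R = divides 0ℤ (ℤ.+-inverseʳ R)
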